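{- Let $(Q,q_I,R,\delta,F)$ be a register transducer with input alphabet $\Gamma$ and output alphabet $\Sigma$, and let $w=w_1\cdots w_n\in\Gamma^*$. Then the image of $w$ by this register transducer is $\varphi(G(q_I))$, where $G=\delta^O(w_1,\delta^O(w_2,\ldots\delta^O(w_n,F)\ldots))$ and $\varphi:(\Sigma\cup R)^*\to\Sigma^*$ is the monoid morphism erasing all letters of $R$ and fixing letters of $\Sigma$.
   Context: A register transducer over finite alphabets $\Gamma,\Sigma$ consists of a finite set $Q$ of states with initial state $q_I$, a finite set $R$ of registers disjoint from $\Gamma,\Sigma$, a transition function $\delta:Q\times\Gamma\to Q\times((\Sigma\cup R)^*)^R$ and an output function $F:Q\to(\Sigma\cup R)^*$. Configurations are pairs $(q,s)$ with $s:R\to\Sigma^*$; for $c\in\Gamma$, $(q,s)\to_c(q',s')$ when $(q',u)=\delta(q,c)$ and $s'=s^*\circ u$, where $s^*:(\Sigma\cup R)^*\to\Sigma^*$ is the monoid morphism fixing letters of $\Sigma$ and sending $r\in R$ to $s(r)$. The image of $w=w_1\cdots w_n$ is $s^*(F(q))$ where $(q_I,(r\mapsto\varepsilon))\to_{w_1}\cdots\to_{w_n}(q,s)$. Define $\delta^O:\Gamma\times((\Sigma\cup R)^*)^Q\to((\Sigma\cup R)^*)^Q$ by $\delta^O(a,G)=(q\mapsto s_{a,q}^*(G(q'_{a,q})))$, where $(q'_{a,q},s_{a,q})=\delta(q,a)$ and $s_{a,q}^*:(\Sigma\cup R)^*\to(\Sigma\cup R)^*$ is the monoid morphism fixing letters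 of $\Sigma$ and sending $r\in R$ to $s_{a,q}(r)$. -}

module Defs where

open import Data.Nat using (ℕ)
open import Data.Fin using (Fin)
open import Data.List using (List; []; _∷_; concatMap; foldl; foldr)
open import Data.Sum using (_⊎_; inj₁; inj₂)
open import Data.Product using (_×_; _,_; proj₁; proj₂)

-- Finite alphabets / state sets / register sets are represented by Fin types.
-- The letter set  Σ ∪ R  (disjoint union) is  Fin σ ⊎ Fin r.

record RegisterTransducer (γ σ : ℕ) : Set where
  field
    nQ  : ℕ
    nR  : ℕ
    qI  : Fin nQ
    δ   : Fin nQ → Fin γ → Fin nQ × (Fin nR → List (Fin σ ⊎ Fin nR))
    F   : Fin nQ → List (Fin σ ⊎ Fin nR)

open RegisterTransducer public

extend : {S R A : Set} → (S → List A) → (R → List A) → List (S ⊎ R) → List A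
extend ι s = concatMap λ { (inj₁ a) → ι a ; (inj₂ r) → s r }

module _ {γ σ : ℕ} (T : RegisterTransducer γ σ) where

  Letter : Set
  Letter = Fin σ ⊎ Fin (nR T)

  Valuation : Set
  Valuation = Fin (nR T) → List (Fin σ)

  Config : Set
  Config = Fin (nQ T) × Valuation

  sStar : Valuation → List Letter → List (Fin σ)
  sStar s = extend (λ a → a ∷ []) s

  step : Config → Fin γ → Config
  step (q , s) c = proj₁ (δ T q c) , λ r → sStar s (proj₂ (δ T q c) r)

  initialConfig : Config
  initialConfig = qI T , λ _ → []

  run : List (Fin γ) → Config
  run w = foldl step initialConfig w

  image : List (Fin γ) → List (Fin σ)
  image w = sStar (proj₂ (run w)) (F T (proj₁ (run w)))

  δO : Fin γ → (Fin (nQ T) → List Letter) → (Fin (nQ T) → List Letter)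
  δO a G q = extend (λ b → inj₁ b ∷ []) (proj₂ (δ T q a)) (G (proj₁ (δ T q a)))

  Gof : List (Fin γ) → (Fin (nQ T) → List Letter)
  Gof w = foldr δO (F T) w

  φ : List Letter → List (Fin σ)
  φ = extend (λ a → a ∷ []) (λ _ → [])

-- Substituting register contents commutes with register updates: s^*(s_{a,q}^*(G q'))
-- is s'^*(G q') for the successor valuation s'. Hence s^*(G(q)) is invariant along the
-- run when G is transformed by δ^O, and at the start the valuation is empty, where s^*
-- is φ (definitionally).
module Submission where

open import Defs
open import Data.Nat using (ℕ)
open import Data.Fin using (Fin)
open import Data.List using (List; []; _∷_; _++_; foldl)
open import Data.List.Properties using (concatMap-++)
open import Data.Sum using (_⊎_; inj₁; inj₂)
open import Data.Product using (_,_; proj₁; proj₂)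
open import Function using (_∘_)
open import Relation.Binary.PropositionalEquality using (_≡_; refl; cong; module ≡-Reasoning)

extend-∘-extend : {S R A : Set} (ι : S → List A) (t : R → List A) (u : R → List (S ⊎ R))
  (xs : List (S ⊎ R)) →
  extend ι t (extend (λ b → inj₁ b ∷ []) u xs) ≡ extend ι (extend ι t ∘ u) xs
extend-∘-extend ι t u [] = refl
extend-∘-extend ι t u (inj₁ b ∷ xs) = cong (ι b ++_) (extend-∘-extend ι t u xs)
extend-∘-extend ι t u (inj₂ r ∷ xs) = begin
  extend ι t (u r ++ extend (λ b → inj₁ b ∷ []) u xs)
    ≡⟨ concatMap-++ _ (u r) _ ⟩
  extend ι t (u r) ++ extend ι t (extend (λ b → inj₁ b ∷ []) u xs)
    ≡⟨ cong (extend ι t (u r) ++_) (extend-∘-extend ι t u xs) ⟩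
  extend ι t (u r) ++ extend ι (extend ι t ∘ u) xs
    ∎
  where open ≡-Reasoning

module _ {γ σ : ℕ} (T : RegisterTransducer γ σ) where

  outputFrom : Config T → List (Fin γ) → List (Fin σ)
  outputFrom c w = sStar T (proj₂ (foldl (step T) c w)) (F T (proj₁ (foldl (step T) c w)))

  sStar-δO : (q : Fin (nQ T)) (s : Valuation T) (a : Fin γ) (G : Fin (nQ T) → List (Letter T)) →
    sStar T s (δO T a G q) ≡ sStar T (proj₂ (step T (q , s) a)) (G (proj₁ (δ T q a)))
  sStar-δO q s a G = extend-∘-extend (λ b → b ∷ []) s (proj₂ (δ T q a)) (G (proj₁ (δ T q a)))

  outputFrom≡sStar-Gof : (c : Config T) (w : List (Fin γ)) →
    outputFrom c w ≡ sStar T (proj₂ c) (Gof T w (proj₁ c))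
  outputFrom≡sStar-Gof c [] = refl
  outputFrom≡sStar-Gof (q , s) (a ∷ w) = begin
    outputFrom (step T (q , s) a) w
      ≡⟨ outputFrom≡sStar-Gof (step T (q , s) a) w ⟩
    sStar T (proj₂ (step T (q , s) a)) (Gof T w (proj₁ (δ T q a)))
      ≡⟨ sStar-δO q s a (Gof T w) ⟨
    sStar T s (Gof T (a ∷ w) q)
      ∎
    where open ≡-Reasoning

proposition37 : {γ σ : ℕ} (T : RegisterTransducer γ σ) (w : List (Fin γ)) →
    image T w ≡ φ T (Gof T w (qI T))
proposition37 T w = outputFrom≡sStar-Gof T (initialConfig T) w
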